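{- Let $V$ be a finite set and let $\mathcal{P}$, $\mathcal{P}'$ be partitions of $V$ with $\vert\mathcal{P}'\vert \ge 2$. Define $\phi^* : 2^{\mathcal{P}} \to \mathbb{R}_{\geq 0}$ by $\phi^*(\mathcal{S}) = 0$ if $\mathcal{S} \in \{\emptyset, \mathcal{P}\}$ and $\phi^*(\mathcal{S}) = \min_{\emptyset \neq \mathcal{S}' \subsetneq \mathcal{P}'} \vert U_{\mathcal{S}} \triangle U_{\mathcal{S}'} \vert$ otherwise. Then $\phi^*$ is symmetric, i.e. $\phi^*(\mathcal{S}) = \phi^*(\mathcal{P}\setminus\mathcal{S})$ for all $\mathcal{S}\subseteq\mathcal{P}$; and $\phi^*$ is not submodular in general, i.e. there exist $V$, $\mathcal{P}$, $\mathcal{P}'$ and $\mathcal{S}, \mathcal{T} \subseteq \mathcal{P}$ with $\phi^*(\mathcal{S}\cup\mathcal{T}) > \phi^*(\mathcal{S}) + \phi^*(\mathcal{T}) - \phi^*(\mathcal{S}\cap\mathcal{T})$.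
   Context: $U_{\mathcal{S}}$ denotes the union of the members of $\mathcal{S}$; $\triangle$ is symmetric difference; $\vert\cdot\vert$ is cardinality (or total weight, if elements carry positive weights). -}

module Defs where

open import Data.Nat using (ℕ; zero; suc; _⊓_)
open import Data.Bool using (Bool; true; false; _xor_; _∧_; if_then_else_; not)
open import Data.Fin using (Fin)
open import Data.Fin.Subset using (Subset; ∣_∣)
open import Data.Vec using (Vec; []; _∷_; tabulate; lookup; zipWith; foldr′; map)
open import Data.List using (List; []; _∷_; _++_; filter; foldr)
import Data.List as List
open import Data.Product using (Σ; _×_)
open import Function.Definitions using (Surjective)
open import Relation.Binary.PropositionalEquality using (_≡_)
open import Relation.Nullary.Decidable using (yes; no)
open import Data.Bool.Properties using (T?)

-- A partition 𝒫 of V into k blocks is encoded by a block-assignment map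
-- p : Fin n → Fin k that is surjective (every block is nonempty);
-- block i of 𝒫 is { v | p v ≡ i }.
IsPartition : {n k : ℕ} → (Fin n → Fin k) → Set
IsPartition {n} {k} p = Surjective _≡_ _≡_ p

-- A subfamily 𝒮 ⊆ 𝒫 is a subset of the block indices, Subset k.
-- U_𝒮 : the union of the blocks in 𝒮, as a subset of V.
U : {n k : ℕ} → (Fin n → Fin k) → Subset k → Subset n
U p S = tabulate (λ v → lookup S (p v))

_△_ : {n : ℕ} → Subset n → Subset n → Subset n
A △ B = zipWith _xor_ A B

allSubsets : (k : ℕ) → List (Subset k)
allSubsets zero = [] ∷ []
allSubsets (suc k) = List.map (false ∷_) (allSubsets k) ++ List.map (true ∷_) (allSubsets k)

isEmptyB : {k : ℕ} → Subset k → Bool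
isEmptyB S = foldr′ (λ b acc → not b ∧ acc) true S

isFullB : {k : ℕ} → Subset k → Bool
isFullB S = foldr′ (λ b acc → b ∧ acc) true S

isProperNonemptyB : {k : ℕ} → Subset k → Bool
isProperNonemptyB S = not (isEmptyB S) ∧ not (isFullB S)

-- minimum of a list of naturals (the default 0 for [] is never used in
-- the statement, since there |𝒫'| ≥ 2 makes the candidate list nonempty)
minList : List ℕ → ℕ
minList [] = 0
minList (x ∷ xs) = foldr _⊓_ x xs

phiStar : {n k k' : ℕ} → (Fin n → Fin k) → (Fin n → Fin k') → Subset k → ℕ
phiStar {n} {k} {k'} p p' S =
  if isEmptyB S then 0 else
  if isFullB S then 0 else
  minList (List.map (λ S' → ∣ U p S △ U p' S' ∣)
                    (filter (λ S' → T? (isProperNonemptyB S')) (allSubsets k')))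

-- Symmetry: complementing 𝒮 and 𝒮' together complements both unions, which leaves
-- |U_𝒮 △ U_𝒮'| unchanged, and the proper nonempty 𝒮' are closed under complement; so
-- φ*(𝒮) and φ*(𝒫 ∖ 𝒮) minimise over the same set of values.
module Submission where

open import Defs
open import Data.Nat using (ℕ; zero; suc; _≤_; _>_; _+_; _⊓_; s≤s; z≤n)
open import Data.Nat.Properties using (≤-refl; ≤-antisym; ⊓-sel; m≤n⇒m⊓o≤n; m≤n⇒o⊓m≤n)
open import Data.Bool using (true; false; not; _xor_; T)
open import Data.Bool.Properties using (T?; not-involutive; ∧-comm)
open import Data.Fin using (Fin; zero; suc)
open import Data.Fin.Subset using (Subset; ∁; _∪_; _∩_; ∣_∣)
open import Data.Vec using ([]; _∷_; tabulate; lookup; map)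
open import Data.Vec.Properties using (lookup-map; tabulate-∘; tabulate-cong; map-∘; map-cong; map-id)
open import Data.List using (List; []; _∷_; filter)
import Data.List as List
open import Data.List.Properties using (foldr-preservesᵒ)
open import Data.List.Relation.Unary.Any as Any using (Any; here; there)
open import Data.List.Membership.Propositional using (_∈_)
open import Data.List.Membership.Propositional.Properties
  using (foldr-selective; ∈-map⁺; ∈-map⁻; ∈-filter⁺; ∈-filter⁻; ∈-++⁺ˡ; ∈-++⁺ʳ)
open import Data.List.Relation.Binary.Subset.Propositional using (_⊆_)
open import Data.Sum using (_⊎_; inj₁; inj₂)
open import Data.Product using (Σ; _×_; ∃-syntax; _,_)
open import Relation.Binary.PropositionalEquality using (_≡_; refl; sym; cong; cong₂; subst)
open Relation.Binary.PropositionalEquality.≡-Reasoning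

minList-∈ : ∀ x xs → minList (x ∷ xs) ∈ x ∷ xs
minList-∈ x xs with foldr-selective ⊓-sel x xs
... | inj₁ min≡x   = here min≡x
... | inj₂ min∈xs  = there min∈xs

minList-≤ : ∀ {x xs y} → y ∈ x ∷ xs → minList (x ∷ xs) ≤ y
minList-≤ {x} {xs} {y} y∈ = foldr-preservesᵒ ⊓-≤ x xs (leq y∈)
  where
  ⊓-≤ : ∀ a b → a ≤ y ⊎ b ≤ y → a ⊓ b ≤ y
  ⊓-≤ a b (inj₁ a≤y) = m≤n⇒m⊓o≤n b a≤y
  ⊓-≤ a b (inj₂ b≤y) = m≤n⇒o⊓m≤n a b≤y
  leq : y ∈ x ∷ xs → x ≤ y ⊎ Any (_≤ y) xs
  leq (here refl)  = inj₁ ≤-refl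
  leq (there y∈xs) = inj₂ (Any.map (λ { refl → ≤-refl }) y∈xs)

minList-cong : ∀ {xs ys} → xs ⊆ ys → ys ⊆ xs → minList xs ≡ minList ys
minList-cong {[]}     {[]}     _     _     = refl
minList-cong {[]}     {y ∷ ys} _     ys⊆[] with ys⊆[] (here refl)
... | ()
minList-cong {x ∷ xs} {[]}     xs⊆[] _     with xs⊆[] (here refl)
... | ()
minList-cong {x ∷ xs} {y ∷ ys} xs⊆ys ys⊆xs = ≤-antisym
  (minList-≤ (ys⊆xs (minList-∈ y ys)))
  (minList-≤ (xs⊆ys (minList-∈ x xs)))

∈-allSubsets : ∀ {k} (S : Subset k) → S ∈ allSubsets k
∈-allSubsets {k = zero} []          = here refl
∈-allSubsets {k = suc k} (false ∷ S) = ∈-++⁺ˡ (∈-map⁺ (false ∷_) (∈-allSubsets S))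
∈-allSubsets {k = suc k} (true ∷ S)  =
  ∈-++⁺ʳ (List.map (false ∷_) (allSubsets k)) (∈-map⁺ (true ∷_) (∈-allSubsets S))

∁-involutive : ∀ {k} (S : Subset k) → ∁ (∁ S) ≡ S
∁-involutive S = begin
  map not (map not S) ≡⟨ map-∘ not not S ⟨
  map (λ b → not (not b)) S ≡⟨ map-cong not-involutive S ⟩
  map (λ b → b) S ≡⟨ map-id S ⟩
  S ∎

isEmptyB-∁ : ∀ {k} (S : Subset k) → isEmptyB (∁ S) ≡ isFullB S
isEmptyB-∁ []          = refl
isEmptyB-∁ (true ∷ S)  = isEmptyB-∁ S
isEmptyB-∁ (false ∷ S) = refl

isFullB-∁ : ∀ {k} (S : Subset k) → isFullB (∁ S) ≡ isEmptyB S
isFullB-∁ []          = refl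
isFullB-∁ (true ∷ S)  = refl
isFullB-∁ (false ∷ S) = isFullB-∁ S

isProperNonemptyB-∁ : ∀ {k} (S : Subset k) → isProperNonemptyB (∁ S) ≡ isProperNonemptyB S
isProperNonemptyB-∁ S rewrite isEmptyB-∁ S | isFullB-∁ S =
  ∧-comm (not (isFullB S)) (not (isEmptyB S))

U-∁ : ∀ {n k} (p : Fin n → Fin k) (S : Subset k) → U p (∁ S) ≡ ∁ (U p S)
U-∁ p S = begin
  tabulate (λ v → lookup (map not S) (p v)) ≡⟨ tabulate-cong (λ v → lookup-map (p v) not S) ⟩
  tabulate (λ v → not (lookup S (p v)))     ≡⟨ tabulate-∘ not (λ v → lookup S (p v)) ⟩
  map not (U p S) ∎

∁-△-∁ : ∀ {n} (A B : Subset n) → ∁ A △ ∁ B ≡ A △ B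
∁-△-∁ []      []      = refl
∁-△-∁ (a ∷ A) (b ∷ B) = cong₂ _∷_ (not-xor-not a b) (∁-△-∁ A B)
  where
  not-xor-not : ∀ a b → not a xor not b ≡ a xor b
  not-xor-not true  _ = refl
  not-xor-not false b = not-involutive b

properNonemptySubsets : ∀ k → List (Subset k)
properNonemptySubsets k = filter (λ S' → T? (isProperNonemptyB S')) (allSubsets k)

∁-∈-properNonemptySubsets : ∀ {k} {S : Subset k} →
  S ∈ properNonemptySubsets k → ∁ S ∈ properNonemptySubsets k
∁-∈-properNonemptySubsets {k} {S} S∈ =
  let _ , proper = ∈-filter⁻ (λ S' → T? (isProperNonemptyB S')) {xs = allSubsets k} S∈
  in ∈-filter⁺ (λ S' → T? (isProperNonemptyB S')) (∈-allSubsets (∁ S))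
       (subst T (sym (isProperNonemptyB-∁ S)) proper)

module _ {n k k'} (p : Fin n → Fin k) (p' : Fin n → Fin k') where

  distances : Subset k → List ℕ
  distances S = List.map (λ S' → ∣ U p S △ U p' S' ∣) (properNonemptySubsets k')

  distances-∁-⊆ : ∀ S → distances (∁ S) ⊆ distances S
  distances-∁-⊆ S d∈ with ∈-map⁻ _ d∈
  ... | S' , S'∈ , refl = subst (_∈ distances S) same (∈-map⁺ _ (∁-∈-properNonemptySubsets S'∈))
    where
    same : ∣ U p S △ U p' (∁ S') ∣ ≡ ∣ U p (∁ S) △ U p' S' ∣
    same = cong ∣_∣ (begin
      U p S △ U p' (∁ S')         ≡⟨ ∁-△-∁ (U p S) (U p' (∁ S')) ⟨
      ∁ (U p S) △ ∁ (U p' (∁ S')) ≡⟨ cong₂ _△_ (U-∁ p S) (U-∁ p' (∁ S')) ⟨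
      U p (∁ S) △ U p' (∁ (∁ S')) ≡⟨ cong (λ X → U p (∁ S) △ U p' X) (∁-involutive S') ⟩
      U p (∁ S) △ U p' S' ∎)

  distances-⊆-∁ : ∀ S → distances S ⊆ distances (∁ S)
  distances-⊆-∁ S = subst (λ X → distances X ⊆ distances (∁ S)) (∁-involutive S) (distances-∁-⊆ (∁ S))

  phiStar-∁ : ∀ S → phiStar p p' S ≡ phiStar p p' (∁ S)
  phiStar-∁ S rewrite isEmptyB-∁ S | isFullB-∁ S with isEmptyB S | isFullB S
  ... | true  | true  = refl
  ... | true  | false = refl
  ... | false | true  = refl
  ... | false | false = minList-cong (distances-⊆-∁ S) (distances-∁-⊆ S)

-- 𝒫 = {{0,1},{2},{3}} and 𝒫' = {{0,1,2},{3}} on V = {0,1,2,3}.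
blocks : Fin 4 → Fin 3
blocks zero                   = zero
blocks (suc zero)             = zero
blocks (suc (suc zero))       = suc zero
blocks (suc (suc (suc zero))) = suc (suc zero)

blocks' : Fin 4 → Fin 2
blocks' (suc (suc (suc zero))) = suc zero
blocks' _                      = zero

blocks-partition : IsPartition blocks
blocks-partition zero             = zero , λ { refl → refl }
blocks-partition (suc zero)       = suc (suc zero) , λ { refl → refl }
blocks-partition (suc (suc zero)) = suc (suc (suc zero)) , λ { refl → refl }

blocks'-partition : IsPartition blocks'
blocks'-partition zero       = zero , λ { refl → refl }
blocks'-partition (suc zero) = suc (suc (suc zero)) , λ { refl → refl }

proposition8 :
    ((n k k' : ℕ) (p : Fin n → Fin k) (p' : Fin n → Fin k') →
      IsPartition p → IsPartition p' → 2 ≤ k' →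
      (S : Subset k) → phiStar p p' S ≡ phiStar p p' (∁ S))
    ×
    (∃[ n ] ∃[ k ] ∃[ k' ] Σ (Fin n → Fin k) λ p → Σ (Fin n → Fin k') λ p' →
      IsPartition p × IsPartition p' × 2 ≤ k' ×
      (∃[ S ] ∃[ T ]
        phiStar p p' (S ∪ T) + phiStar p p' (S ∩ T) > phiStar p p' S + phiStar p p' T))
proposition8 =
  (λ _ _ _ p p' _ _ _ → phiStar-∁ p p')
  , (4 , 3 , 2 , blocks , blocks' , blocks-partition , blocks'-partition , s≤s (s≤s z≤n)
    -- 𝒮 = {{3}}, 𝒯 = {{0,1}}: φ*(𝒮 ∪ 𝒯) + φ*(𝒮 ∩ 𝒯) = 2 + 0 > 0 + 1 = φ*(𝒮) + φ*(𝒯).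
    , (false ∷ false ∷ true ∷ []) , (true ∷ false ∷ false ∷ []) , s≤s (s≤s z≤n))
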